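{- Let $G$ be a triangle-free graph that has exactly two connected components, one of which is trivial (a single vertex). Then $rc(\overline{G})\leq 6$.
   Context: All graphs are finite, undirected and simple. For an edge-coloring $c:E(H)\to\{1,\dots,k\}$ (adjacent edges may receive the same color), a path is rainbow if no two of its edges have the same color; $H$ is rainbow connected under $c$ if every two vertices are joined by a rainbow path. The rainbow connection number $rc(H)$ of a nontrivial connected graph $H$ is the minimum $k$ for which such a coloring with $k$ colors exists. $\overline{G}$ denotes the complement of $G$. -}

module Defs where

open import Data.Nat using (ℕ; zero; suc)
open import Data.Fin using (Fin)
open import Data.Bool using (Bool; true; false; not; _∧_; T)
open import Data.List using (List; []; _∷_)
open import Data.List.Relation.Unary.Unique.Propositional using (Unique)
open import Data.Product using (Σ; ∃; _×_)
open import Data.Empty using (⊥)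
open import Relation.Nullary using (¬_; does)
open import Relation.Binary.PropositionalEquality using (_≡_; _≢_)
open import Data.Fin using (_≟_)

record Graph (n : ℕ) : Set where
  field
    adj    : Fin n → Fin n → Bool
    sym    : ∀ u v → adj u v ≡ adj v u
    irrefl : ∀ u → adj u u ≡ false
open Graph public

Edge : ∀ {n} → Graph n → Fin n → Fin n → Set
Edge G u v = T (adj G u v)

complement : ∀ {n} → Graph n → Graph n
complement {n} G = record { adj = a ; sym = s ; irrefl = i }
  where
  a : Fin n → Fin n → Bool
  a u v = not (does (u ≟ v)) ∧ not (adj G u v)
  s : ∀ u v → a u v ≡ a v u
  s u v with u ≟ v | v ≟ u
  ... | Relation.Nullary.yes _ | Relation.Nullary.yes _ = Relation.Binary.PropositionalEquality.refl
  ... | Relation.Nullary.yes p | Relation.Nullary.no q = Data.Empty.⊥-elim (q (Relation.Binary.PropositionalEquality.sym p))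
  ... | Relation.Nullary.no q | Relation.Nullary.yes p = Data.Empty.⊥-elim (q (Relation.Binary.PropositionalEquality.sym p))
  ... | Relation.Nullary.no _ | Relation.Nullary.no _ rewrite Graph.sym G u v = Relation.Binary.PropositionalEquality.refl
  i : ∀ u → a u u ≡ false
  i u with u ≟ u
  ... | Relation.Nullary.yes _ = Relation.Binary.PropositionalEquality.refl
  ... | Relation.Nullary.no q = Data.Empty.⊥-elim (q Relation.Binary.PropositionalEquality.refl)

TriangleFree : ∀ {n} → Graph n → Set
TriangleFree G = ∀ a b c → Edge G a b → Edge G b c → Edge G a c → ⊥

data IsWalk {n} (G : Graph n) : Fin n → Fin n → List (Fin n) → Set where
  nil  : ∀ {u} → IsWalk G u u (u ∷ [])
  cons : ∀ {u v w xs} → Edge G u v → IsWalk G v w xs → IsWalk G u w (u ∷ xs)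

Reachable : ∀ {n} → Graph n → Fin n → Fin n → Set
Reachable G u w = ∃ λ xs → IsWalk G u w xs

-- G has exactly two connected components, one of which is the single vertex v:
-- the component of v is {v}, there is another vertex, and all vertices other
-- than v lie in one common component.
TwoComponentsOneTrivial : ∀ {n} → Graph n → Set
TwoComponentsOneTrivial {n} G =
  Σ (Fin n) λ v →
    (∀ u → Reachable G v u → u ≡ v) ×
    (∃ λ u → u ≢ v) ×
    (∀ u w → u ≢ v → w ≢ v → Reachable G u w)

-- An edge-colouring with k colours (colour of edge uv is c u v = c v u;
-- values on non-edges are irrelevant).
record EdgeColoring {n} (G : Graph n) (k : ℕ) : Set where
  field
    col : Fin n → Fin n → Fin k
    col-sym : ∀ u v → col u v ≡ col v u
open EdgeColoring public

edgeColors : ∀ {n k} → (Fin n → Fin n → Fin k) → List (Fin n) → List (Fin k)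
edgeColors c (x ∷ y ∷ r) = c x y ∷ edgeColors c (y ∷ r)
edgeColors c _ = []

RainbowPath : ∀ {n k} (G : Graph n) → EdgeColoring G k → Fin n → Fin n → Set
RainbowPath G c u w =
  ∃ λ xs → IsWalk G u w xs × Unique xs × Unique (edgeColors (col c) xs)

RainbowConnected : ∀ {n k} (G : Graph n) → EdgeColoring G k → Set
RainbowConnected G c = ∀ u w → RainbowPath G c u w

RcAtMost : ∀ {n} → Graph n → ℕ → Set
RcAtMost G k = Σ (EdgeColoring G k) λ c → RainbowConnected G c

-- The trivial component is a vertex v adjacent in the complement to every other
-- vertex, so any two vertices that are non-adjacent in G are joined directly and
-- every other pair is joined through v. Fix an edge ab of G and colour the spoke
-- vx by the class of x: 0 on N(a), 1 on N(b) ∖ N(a), 2 elsewhere; all remaining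
-- edges get colour 3. For an edge uw of G, triangle-freeness forbids u, w both in
-- N(a) or both in N(b), so either their classes differ and u v w is rainbow, or
-- both have class 2 and u a v w is rainbow with colours 3, 1, 2. So four colours
-- suffice, and only the isolated vertex is used, not the connectivity of the rest.
module Submission where

open import Defs
open import Data.Nat using (ℕ; _+_)
open import Data.Fin using (Fin; #_; _≟_)
open import Data.Fin.Properties using (any?)
open import Data.Bool using (true; false; T; if_then_else_)
open import Data.Unit using (tt)
open import Data.List using ([]; _∷_)
open import Data.List.Relation.Unary.All using ([]; _∷_)
open import Data.List.Relation.Unary.AllPairs using ([]; _∷_)
open import Data.Product using (_×_; _,_; uncurry)
open import Data.Empty using (⊥-elim)
open import Data.Sum using (_⊎_; inj₁; inj₂; [_,_]′)
open import Relation.Nullary using (¬_; yes; no)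
open import Relation.Nullary.Decidable using (T?)
open import Relation.Binary.PropositionalEquality
  using (_≡_; _≢_; refl; trans; subst; ≢-sym)
  renaming (sym to ≡-sym)

module _ {n : ℕ} (G : Graph n) where

  Edge-irrefl : ∀ {u} → ¬ Edge G u u
  Edge-irrefl {u} = subst T (irrefl G u)

  Edge-sym : ∀ {u w} → Edge G u w → Edge G w u
  Edge-sym {u} {w} = subst T (Graph.sym G u w)

  Edge⇒≢ : ∀ {u w} → Edge G u w → u ≢ w
  Edge⇒≢ e refl = Edge-irrefl e

  complement-Edge : ∀ {u w} → u ≢ w → ¬ Edge G u w → Edge (complement G) u w
  complement-Edge {u} {w} u≢w ¬uw with u ≟ w | adj G u w
  ... | yes u≡w | _     = u≢w u≡w
  ... | no _    | true  = ¬uw tt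
  ... | no _    | false = tt

  Isolated : Fin n → Set
  Isolated v = ∀ x → ¬ Edge G v x

  trivialComponent⇒isolated : ∀ {v} → (∀ u → Reachable G v u → u ≡ v) → Isolated v
  trivialComponent⇒isolated isoR x e with isoR x (_ , cons e nil)
  ... | refl = Edge-irrefl e

  Edge⇒≢isolated : ∀ {v u w} → Isolated v → Edge G u w → u ≢ v
  Edge⇒≢isolated iso e refl = iso _ e

  module _ {k : ℕ} (c : EdgeColoring (complement G) k) where

    trivial-rainbowPath : ∀ u → RainbowPath (complement G) c u u
    trivial-rainbowPath u = u ∷ [] , nil , [] ∷ [] , []

    nonEdge-rainbowPath : ∀ {u w} → u ≢ w → ¬ Edge G u w → RainbowPath (complement G) c u w
    nonEdge-rainbowPath {u} {w} u≢w ¬uw =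
      u ∷ w ∷ [] , cons (complement-Edge u≢w ¬uw) nil , (u≢w ∷ []) ∷ [] ∷ [] , [] ∷ []

    rainbowConnected-complement : (∀ u w → Edge G u w → RainbowPath (complement G) c u w) →
                                  RainbowConnected (complement G) c
    rainbowConnected-complement paths u w with u ≟ w
    ... | yes refl = trivial-rainbowPath u
    ... | no u≢w with T? (adj G u w)
    ...   | yes uw  = paths u w uw
    ...   | no ¬uw = nonEdge-rainbowPath u≢w ¬uw

  edgeless⇒rainbowConnected-complement : ∀ {k} (c : EdgeColoring (complement G) k) →
    (∀ u w → ¬ Edge G u w) → RainbowConnected (complement G) c
  edgeless⇒rainbowConnected-complement c edgeless =
    rainbowConnected-complement c λ u w uw → ⊥-elim (edgeless u w uw)

  constantColoring : ∀ {k} → Fin k → EdgeColoring (complement G) k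
  constantColoring i = record { col = λ _ _ → i ; col-sym = λ _ _ → refl }

module SpokeColoring {n : ℕ} (G : Graph n) (triangleFree : TriangleFree G)
                     {v : Fin n} (v-isolated : Isolated G v)
                     {a b : Fin n} (ab : Edge G a b) (k : ℕ) where

  Colour : Set
  Colour = Fin (4 + k)

  class : Fin n → Colour
  class x = if adj G a x then # 0 else if adj G b x then # 1 else # 2

  col′ : Fin n → Fin n → Colour
  col′ x y with x ≟ v | y ≟ v
  ... | yes _ | _     = class y
  ... | no _  | yes _ = class x
  ... | no _  | no _  = # 3

  col′-sym : ∀ x y → col′ x y ≡ col′ y x
  col′-sym x y with x ≟ v | y ≟ v
  ... | yes refl | yes refl = refl
  ... | yes _    | no _     = refl
  ... | no _     | yes _    = refl
  ... | no _     | no _     = refl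

  coloring : EdgeColoring (complement G) (4 + k)
  coloring = record { col = col′ ; col-sym = col′-sym }

  col′-from-v : ∀ y → col′ v y ≡ class y
  col′-from-v y with v ≟ v
  ... | yes _   = refl
  ... | no v≢v = ⊥-elim (v≢v refl)

  col′-to-v : ∀ {x} → x ≢ v → col′ x v ≡ class x
  col′-to-v x≢v = trans (col′-sym _ v) (col′-from-v _)

  col′-away-from-v : ∀ {x y} → x ≢ v → y ≢ v → col′ x y ≡ # 3
  col′-away-from-v {x} {y} x≢v y≢v with x ≟ v | y ≟ v
  ... | yes x≡v | _       = ⊥-elim (x≢v x≡v)
  ... | no _    | yes y≡v = ⊥-elim (y≢v y≡v)
  ... | no _    | no _    = refl

  Far : Fin n → Set
  Far x = ¬ Edge G a x × ¬ Edge G b x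

  class-far : ∀ {x} → Far x → class x ≡ # 2
  class-far {x} (¬ax , ¬bx) with adj G a x | adj G b x
  ... | true  | _     = ⊥-elim (¬ax tt)
  ... | false | true  = ⊥-elim (¬bx tt)
  ... | false | false = refl

  class-a : class a ≡ # 1
  class-a with adj G a a | irrefl G a | adj G b a | Edge-sym G ab
  ... | false | _ | true | _ = refl

  sameClass⇒commonNeighbour⊎far : ∀ {x y} → class x ≡ class y →
    (Edge G a x × Edge G a y) ⊎ (Edge G b x × Edge G b y) ⊎ (Far x × Far y)
  sameClass⇒commonNeighbour⊎far {x} {y} eq
    with adj G a x | adj G a y | adj G b x | adj G b y | eq
  ... | true  | true  | _     | _     | _  = inj₁ (tt , tt)
  ... | true  | false | _     | true  | ()
  ... | true  | false | _     | false | ()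
  ... | false | true  | true  | _     | ()
  ... | false | true  | false | _     | ()
  ... | false | false | true  | true  | _  = inj₂ (inj₁ (tt , tt))
  ... | false | false | true  | false | ()
  ... | false | false | false | true  | ()
  ... | false | false | false | false | _  = inj₂ (inj₂ (((λ ()) , (λ ())) , ((λ ()) , (λ ()))))

  Edge⇒far-or-classes-differ : ∀ {u w} → Edge G u w → (Far u × Far w) ⊎ class u ≢ class w
  Edge⇒far-or-classes-differ {u} {w} uw with class u ≟ class w
  ... | no ≢class = inj₂ ≢class
  ... | yes ≡class with sameClass⇒commonNeighbour⊎far ≡class
  ...   | inj₁ (au , aw)        = ⊥-elim (triangleFree a u w au uw aw)
  ...   | inj₂ (inj₁ (bu , bw)) = ⊥-elim (triangleFree b u w bu uw bw)
  ...   | inj₂ (inj₂ far)       = inj₁ far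

  spoke : ∀ {x} → x ≢ v → Edge (complement G) v x
  spoke x≢v = complement-Edge G (≢-sym x≢v) (v-isolated _)

  spoke⁻ : ∀ {x} → x ≢ v → Edge (complement G) x v
  spoke⁻ x≢v = complement-Edge G x≢v (λ xv → v-isolated _ (Edge-sym G xv))

  ≢-by-values : ∀ {c d i j : Colour} → c ≡ i → d ≡ j → i ≢ j → c ≢ d
  ≢-by-values refl refl i≢j = i≢j

  rainbowPath-via-v : ∀ {u w} → u ≢ v → w ≢ v → u ≢ w → class u ≢ class w →
                      RainbowPath (complement G) coloring u w
  rainbowPath-via-v {u} {w} u≢v w≢v u≢w ≢class =
    u ∷ v ∷ w ∷ [] ,
    cons (spoke⁻ u≢v) (cons (spoke w≢v) nil) ,
    (u≢v ∷ u≢w ∷ []) ∷ (≢-sym w≢v ∷ []) ∷ [] ∷ [] ,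
    (≢-by-values (col′-to-v u≢v) (col′-from-v w) ≢class ∷ []) ∷ [] ∷ []

  rainbowPath-via-a-v : ∀ {u w} → u ≢ v → w ≢ v → u ≢ w → Far u → Far w →
                        RainbowPath (complement G) coloring u w
  rainbowPath-via-a-v {u} {w} u≢v w≢v u≢w far-u@(¬au , _) far-w =
    u ∷ a ∷ v ∷ w ∷ [] ,
    cons (complement-Edge G u≢a (λ ua → ¬au (Edge-sym G ua)))
      (cons (spoke⁻ a≢v) (cons (spoke w≢v) nil)) ,
    (u≢a ∷ u≢v ∷ u≢w ∷ []) ∷ (a≢v ∷ ≢-sym w≢a ∷ []) ∷ (≢-sym w≢v ∷ []) ∷ [] ∷ [] ,
    (≢-by-values ua-colour av-colour (λ ()) ∷ ≢-by-values ua-colour vw-colour (λ ()) ∷ []) ∷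
    (≢-by-values av-colour vw-colour (λ ()) ∷ []) ∷ [] ∷ []
    where
    far⇒≢a : ∀ {x} → Far x → x ≢ a
    far⇒≢a (_ , ¬bx) refl = ¬bx (Edge-sym G ab)
    u≢a : u ≢ a
    u≢a = far⇒≢a far-u
    w≢a : w ≢ a
    w≢a = far⇒≢a far-w
    a≢v : a ≢ v
    a≢v = Edge⇒≢isolated G v-isolated ab
    ua-colour : col′ u a ≡ # 3
    ua-colour = col′-away-from-v u≢v a≢v
    av-colour : col′ a v ≡ # 1
    av-colour = trans (col′-to-v a≢v) class-a
    vw-colour : col′ v w ≡ # 2
    vw-colour = trans (col′-from-v w) (class-far far-w)

  rainbowConnected : RainbowConnected (complement G) coloring
  rainbowConnected = rainbowConnected-complement G coloring path
    where
    path : ∀ u w → Edge G u w → RainbowPath (complement G) coloring u w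
    path u w uw =
      [ uncurry (rainbowPath-via-a-v u≢v w≢v u≢w) , rainbowPath-via-v u≢v w≢v u≢w ]′
        (Edge⇒far-or-classes-differ uw)
      where
      u≢v : u ≢ v
      u≢v = Edge⇒≢isolated G v-isolated uw
      w≢v : w ≢ v
      w≢v = Edge⇒≢isolated G v-isolated (Edge-sym G uw)
      u≢w : u ≢ w
      u≢w = Edge⇒≢ G uw

proposition4p4 : (n : ℕ) (G : Graph n) → TriangleFree G → TwoComponentsOneTrivial G →
    RcAtMost (complement G) 6
proposition4p4 _ G triangleFree (_ , trivialComponent , _ , _)
  with any? (λ a → any? (λ b → T? (adj G a b)))
... | yes (a , b , ab) = coloring , rainbowConnected
  where open SpokeColoring G triangleFree (trivialComponent⇒isolated G trivialComponent) ab 2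
... | no noEdge =
  constantColoring G (# 0) ,
  edgeless⇒rainbowConnected-complement G (constantColoring G (# 0)) λ a b ab → noEdge (a , b , ab)
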